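{- Let $m>3$ and $n>3$, and let $G$ be the game board consisting of a cycle $C_m$ and a cycle $C_n$ joined at a single common vertex (so $G$ is the one-vertex union of the two cycles, drawn in the plane with the two cycles bounding two distinct cells). If $m$ and $n$ have different parity, then Player~1 has a winning strategy in the Game of Cycles on $G$. If $m$ and $n$ are both even, then Player~2 has a winning strategy in the Game of Cycles on $G$.
   Context: The Game of Cycles: the board is a simple planar graph with a fixed planar embedding; its cells are the bounded faces of the embedding. Two players alternate turns; on a turn a player chooses a currently unmarked edge and marks it with an arrow (an orientation), subject to the sink-source rule: no move may create a sink (a vertex all of whose incident edges are marked and point toward it) or a source (a vertex all of whose incident edges are marked and point away from it). A cycle cell is a cell all of whose boundary edges are marked and oriented consistently, all clockwise or all counterclockwise around the cell. The first player to create a cycle cell wins; if no cycle cell is created, the player who makes the last possible legal move wins (a player with no legal move loses). A winning strategy for a player is a strategy guaranteeing that player a win regardless of the opponent's moves. -}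

module Defs where

open import Data.Nat using (ℕ; zero; suc; pred; _<_)
open import Data.Nat.Properties using (_<?_)
open import Data.Fin using (Fin; zero; suc; toℕ; fromℕ<; _↑ˡ_; _↑ʳ_; splitAt; _≟_)
open import Data.Bool using (Bool; true; false; not; if_then_else_)
open import Data.Maybe using (Maybe; just; nothing)
open import Data.Product using (Σ; _×_; _,_)
open import Data.Sum using (_⊎_; inj₁; inj₂; [_,_])
open import Data.List using (List; map)
open import Data.List.Relation.Unary.All using (All)
open import Data.List using (allFin)

open import Relation.Nullary using (¬_; does; yes; no)
open import Relation.Binary.PropositionalEquality using (_≡_)
open import Function using (_∘_)

-- A game board: a (planar, embedded) graph with vertices Fin numV and
-- edges Fin numE, each edge e carrying a reference orientation
-- src e → tgt e, together with its cells (bounded faces).  Each cell is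
-- given by its boundary walk: the list of its boundary edges, in cyclic
-- order, each tagged with the direction in which the walk traverses it
-- (true = from src to tgt, false = from tgt to src).

record Board : Set₁ where
  field
    numV numE : ℕ
    src tgt   : Fin numE → Fin numV
    Cell      : Set
    boundary  : Cell → List (Fin numE × Bool)
open Board public

-- A marking: nothing = unmarked; just true = arrow src→tgt;
-- just false = arrow tgt→src.
Marking : Board → Set
Marking B = Fin (numE B) → Maybe Bool

empty : (B : Board) → Marking B
empty B _ = nothing

update : (B : Board) → Marking B → Fin (numE B) → Bool → Marking B
update B μ e d e' = if does (e' ≟ e) then just d else μ e'

Incident : (B : Board) → Fin (numE B) → Fin (numV B) → Set
Incident B e v = (src B e ≡ v) ⊎ (tgt B e ≡ v)

PointsInto : (B : Board) → Marking B → Fin (numE B) → Fin (numV B) → Set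
PointsInto B μ e v = (μ e ≡ just true × tgt B e ≡ v) ⊎ (μ e ≡ just false × src B e ≡ v)

PointsOut : (B : Board) → Marking B → Fin (numE B) → Fin (numV B) → Set
PointsOut B μ e v = (μ e ≡ just true × src B e ≡ v) ⊎ (μ e ≡ just false × tgt B e ≡ v)

Sink : (B : Board) → Marking B → Fin (numV B) → Set
Sink B μ v = ∀ e → Incident B e v → PointsInto B μ e v

Source : (B : Board) → Marking B → Fin (numV B) → Set
Source B μ v = ∀ e → Incident B e v → PointsOut B μ e v

NoSinkSource : (B : Board) → Marking B → Set
NoSinkSource B μ = ∀ v → ¬ Sink B μ v × ¬ Source B μ v

Legal : (B : Board) → Marking B → Fin (numE B) → Bool → Set
Legal B μ e d = μ e ≡ nothing × NoSinkSource B (update B μ e d)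

CycleCell : (B : Board) → Marking B → Cell B → Set
CycleCell B μ c =
  All (λ { (e , d) → μ e ≡ just d }) (boundary B c)
  ⊎ All (λ { (e , d) → μ e ≡ just (not d) }) (boundary B c)

HasCycleCell : (B : Board) → Marking B → Set
HasCycleCell B μ = Σ (Cell B) (CycleCell B μ)

-- Win B μ : the player to move in position μ has a winning strategy.
-- Lose B μ : the opponent of the player to move has a winning strategy.
-- (The game is finite, so these inductive predicates describe exactly
-- the existence of winning strategies.)
data Win (B : Board) : Marking B → Set
data Lose (B : Board) : Marking B → Set

data Win B where
  win : ∀ {μ} e d → Legal B μ e d →
        HasCycleCell B (update B μ e d) ⊎ Lose B (update B μ e d) →
        Win B μ

data Lose B where
  lose : ∀ {μ} →
         (∀ e d → Legal B μ e d →
            ¬ HasCycleCell B (update B μ e d) × Win B (update B μ e d)) →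
         Lose B μ

Player1Wins : Board → Set
Player1Wins B = Win B (empty B)

Player2Wins : Board → Set
Player2Wins B = Lose B (empty B)

-- Vertices: Fin (suc (a + b)); zero is the shared vertex, suc (i ↑ˡ b)
-- are the other vertices of the first cycle, suc (a ↑ʳ j) those of the
-- second.  Edges: Fin (suc a + suc b); the first suc a edges form the
-- first cycle, the rest the second.

next : {k : ℕ} → Fin (suc k) → Fin (suc k)
next {k} i with toℕ i <? k
... | yes p = fromℕ< (Data.Nat.s≤s p)
... | no _  = zero

pos₁ : (a b : ℕ) → Fin (suc a) → Fin (suc (a Data.Nat.+ b))
pos₁ a b zero    = zero
pos₁ a b (suc i) = suc (i ↑ˡ b)

pos₂ : (a b : ℕ) → Fin (suc b) → Fin (suc (a Data.Nat.+ b))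
pos₂ a b zero    = zero
pos₂ a b (suc j) = suc (a ↑ʳ j)

data TwoCells : Set where
  cell₁ cell₂ : TwoCells

twoCyclesBoard : (a b : ℕ) → Board
twoCyclesBoard a b = record
  { numV = suc (a Data.Nat.+ b)
  ; numE = suc a Data.Nat.+ suc b
  ; src  = λ e → [ pos₁ a b , pos₂ a b ] (splitAt (suc a) e)
  ; tgt  = λ e → [ pos₁ a b ∘ next , pos₂ a b ∘ next ] (splitAt (suc a) e)
  ; Cell = TwoCells
  ; boundary = λ { cell₁ → map (λ i → (i ↑ˡ suc b) , true) (allFin (suc a))
                 ; cell₂ → map (λ j → (suc a ↑ʳ j) , true) (allFin (suc b)) }
  }

-- G = C_m ∪ C_n joined at one vertex (meaningful for m, n ≥ 3)
twoCycles : (m n : ℕ) → Board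
twoCycles m n = twoCyclesBoard (pred m) (pred n)

-- The reflection of the drawing through the shared vertex maps each cycle onto itself, and on a
-- cycle of length k it fixes an edge (the one opposite the shared vertex) exactly when k is odd.
-- The mirror strategy answers every move by the mirror-image move.  In a symmetric position in
-- which no unmarked edge is its own mirror image this answer is always legal: a sink it created at
-- v would come with a source at the mirror vertex τ v, and one of the two would already have existed
-- unless the answered edge joins v and τ v, which only a self-mirror edge can do.  The opponent
-- never completes a cycle cell either, since the mirror image of their edge lies in the same cell
-- and is still unmarked.  So the mirroring player never runs out of moves first.  If both cycles
-- are even no edge is fixed and Player 2 mirrors from the start; if exactly one is odd, Player 1
-- marks its middle edge and mirrors from then on.

module Submission where

open import Defs
open import Data.Bool using (Bool; true; not)
open import Data.Bool.Properties using () renaming (_≟_ to _≟ᵇ_)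
open import Data.Empty using (⊥; ⊥-elim)
open import Data.Fin using (Fin; zero; suc; toℕ; fromℕ<; opposite; _↑ˡ_; _↑ʳ_; splitAt; _≟_)
import Data.Fin.Properties as Finₚ
open import Data.List.Membership.Propositional using (_∈_; find)
open import Data.List.Membership.Propositional.Properties using (∈-map⁺; ∈-map⁻; ∈-allFin)
open import Data.List.Relation.Unary.All as All using (All; all?)
open import Data.List.Relation.Unary.All.Properties using (¬Any⇒All¬)
open import Data.List.Relation.Unary.Any using (any?)
open import Data.Maybe using (Maybe; just; nothing)
import Data.Maybe.Properties as Maybeₚ
open import Data.Nat using (ℕ; zero; suc; _+_; _∸_; _*_; _≤_; _<_; _%_; _/_; ⌊_/2⌋; z≤n; s≤s)
import Data.Nat.Properties as ℕₚ
open import Data.Nat.DivMod using (m%n<n; m≡m%n+[m/n]*n; [m+kn]%n≡m%n)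
open import Data.Nat.Induction using (<-wellFounded)
open import Data.Product using (∃; _×_; _,_; proj₁; proj₂)
open import Data.Sum using (_⊎_; inj₁; inj₂; [_,_])
open import Function using (_∘_)
open import Induction.WellFounded using (Acc; acc)
open import Relation.Nullary using (¬_; Dec; yes; no)
open import Relation.Nullary.Decidable using (dec-true; dec-false; _⊎-dec_)
open import Relation.Binary.PropositionalEquality
  using (_≡_; _≢_; refl; sym; trans; cong; subst; module ≡-Reasoning)

-- Moves on an arbitrary board

nothing≢just : ∀ {A : Set} {x : A} → nothing ≢ just x
nothing≢just ()

sumFin : ∀ {k} → (Fin k → ℕ) → ℕ
sumFin {zero}  f = 0
sumFin {suc k} f = f zero + sumFin (f ∘ suc)

sumFin-mono-≤ : ∀ {k} {f g : Fin k → ℕ} → (∀ x → f x ≤ g x) → sumFin f ≤ sumFin g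
sumFin-mono-≤ {zero}  f≤g = z≤n
sumFin-mono-≤ {suc k} f≤g = ℕₚ.+-mono-≤ (f≤g zero) (sumFin-mono-≤ (f≤g ∘ suc))

sumFin-mono-< : ∀ {k} {f g : Fin k → ℕ} → (∀ x → f x ≤ g x) → ∀ x → f x < g x → sumFin f < sumFin g
sumFin-mono-< {suc k} f≤g zero    f<g = ℕₚ.+-mono-<-≤ f<g (sumFin-mono-≤ (f≤g ∘ suc))
sumFin-mono-< {suc k} f≤g (suc x) f<g = ℕₚ.+-mono-≤-< (f≤g zero) (sumFin-mono-< (f≤g ∘ suc) x f<g)

countNothing : Maybe Bool → ℕ
countNothing nothing  = 1
countNothing (just _) = 0

OnBoundary : (B : Board) → Cell B → Fin (numE B) → Set
OnBoundary B c e = ∃ λ d → (e , d) ∈ boundary B c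

cycleCell? : (B : Board) (μ : Marking B) (c : Cell B) → Dec (CycleCell B μ c)
cycleCell? B μ c =
  all? (λ { (e , d) → Maybeₚ.≡-dec _≟ᵇ_ (μ e) (just d) }) (boundary B c)
  ⊎-dec all? (λ { (e , d) → Maybeₚ.≡-dec _≟ᵇ_ (μ e) (just (not d)) }) (boundary B c)

module MarkingProperties (B : Board) where

  update-≡ : ∀ (μ : Marking B) e d → update B μ e d e ≡ just d
  update-≡ μ e d rewrite dec-true (e ≟ e) refl = refl

  update-≢ : ∀ (μ : Marking B) {e x} d → x ≢ e → update B μ e d x ≡ μ x
  update-≢ μ {e} {x} d x≢e rewrite dec-false (x ≟ e) x≢e = refl

  update-preserves : ∀ (μ : Marking B) e {x d} → μ x ≡ just d → update B μ e d x ≡ just d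
  update-preserves μ e {x} {d} μx≡d with x ≟ e
  ... | yes refl = refl
  ... | no _     = μx≡d

  update-unmarked : ∀ (μ : Marking B) e d {x} → update B μ e d x ≡ nothing → μ x ≡ nothing
  update-unmarked μ e d {x} un with x ≟ e
  ... | no _ = un

  unmarkedCount : Marking B → ℕ
  unmarkedCount μ = sumFin (countNothing ∘ μ)

  update-decreases-unmarkedCount : ∀ (μ : Marking B) e d → μ e ≡ nothing →
                                   unmarkedCount (update B μ e d) < unmarkedCount μ
  update-decreases-unmarkedCount μ e d un = sumFin-mono-< pointwise e strict
    where
    pointwise : ∀ x → countNothing (update B μ e d x) ≤ countNothing (μ x)
    pointwise x with x ≟ e
    ... | yes _ = z≤n
    ... | no _  = ℕₚ.≤-refl
    strict : countNothing (update B μ e d e) < countNothing (μ e)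
    strict rewrite update-≡ μ e d | un = s≤s z≤n

  Incident? : ∀ e v → Dec (Incident B e v)
  Incident? e v = (src B e ≟ v) ⊎-dec (tgt B e ≟ v)

  cycleCell-marked : ∀ {μ : Marking B} {c e} → CycleCell B μ c → OnBoundary B c e → μ e ≢ nothing
  cycleCell-marked (inj₁ along)   (_ , e∈c) un = nothing≢just (trans (sym un) (All.lookup along e∈c))
  cycleCell-marked (inj₂ against) (_ , e∈c) un = nothing≢just (trans (sym un) (All.lookup against e∈c))

  new-cycleCell-contains-move : ∀ {μ : Marking B} {e d c} → ¬ HasCycleCell B μ →
                                CycleCell B (update B μ e d) c → OnBoundary B c e
  new-cycleCell-contains-move {μ} {e} {d} {c} noCycle cycle
    with any? (λ p → proj₁ p ≟ e) (boundary B c)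
  ... | no miss = ⊥-elim (noCycle (c , unchanged cycle))
    where
    unchanged-at : ∀ {f d′} → f ≢ e → update B μ e d f ≡ just d′ → μ f ≡ just d′
    unchanged-at f≢e = trans (sym (update-≢ μ d f≢e))
    untouched : All (λ p → proj₁ p ≢ e) (boundary B c)
    untouched = ¬Any⇒All¬ _ miss
    unchanged : CycleCell B (update B μ e d) c → CycleCell B μ c
    unchanged (inj₁ along)   = inj₁ (All.zipWith (λ (f≢e , eq) → unchanged-at f≢e eq) (untouched , along))
    unchanged (inj₂ against) = inj₂ (All.zipWith (λ (f≢e , eq) → unchanged-at f≢e eq) (untouched , against))
  ... | yes hit with find hit
  ...   | (_ , d′) , mem , refl = d′ , mem

  points-into-and-out⇒loop : ∀ {μ : Marking B} {e v} → PointsInto B μ e v → PointsOut B μ e v →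
                             src B e ≡ tgt B e
  points-into-and-out⇒loop (inj₁ (_ , tgt≡v)) (inj₁ (_ , src≡v)) = trans src≡v (sym tgt≡v)
  points-into-and-out⇒loop (inj₂ (_ , src≡v)) (inj₂ (_ , tgt≡v)) = trans src≡v (sym tgt≡v)
  points-into-and-out⇒loop (inj₁ (μe≡t , _)) (inj₂ (μe≡f , _)) with () ← trans (sym μe≡t) μe≡f
  points-into-and-out⇒loop (inj₂ (μe≡f , _)) (inj₁ (μe≡t , _)) with () ← trans (sym μe≡t) μe≡f

  unmarked-¬PointsInto : ∀ {μ : Marking B} {e v} → μ e ≡ nothing → ¬ PointsInto B μ e v
  unmarked-¬PointsInto un (inj₁ (μe≡t , _)) = nothing≢just (trans (sym un) μe≡t)
  unmarked-¬PointsInto un (inj₂ (μe≡f , _)) = nothing≢just (trans (sym un) μe≡f)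

  unmarked-¬PointsOut : ∀ {μ : Marking B} {e v} → μ e ≡ nothing → ¬ PointsOut B μ e v
  unmarked-¬PointsOut un (inj₁ (μe≡t , _)) = nothing≢just (trans (sym un) μe≡t)
  unmarked-¬PointsOut un (inj₂ (μe≡f , _)) = nothing≢just (trans (sym un) μe≡f)

  PointsInto-resp : ∀ {μ μ′ : Marking B} {e v} → μ′ e ≡ μ e → PointsInto B μ′ e v → PointsInto B μ e v
  PointsInto-resp eq (inj₁ (μe≡t , tgt≡v)) = inj₁ (trans (sym eq) μe≡t , tgt≡v)
  PointsInto-resp eq (inj₂ (μe≡f , src≡v)) = inj₂ (trans (sym eq) μe≡f , src≡v)

  PointsOut-resp : ∀ {μ μ′ : Marking B} {e v} → μ′ e ≡ μ e → PointsOut B μ′ e v → PointsOut B μ e v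
  PointsOut-resp eq (inj₁ (μe≡t , src≡v)) = inj₁ (trans (sym eq) μe≡t , src≡v)
  PointsOut-resp eq (inj₂ (μe≡f , tgt≡v)) = inj₂ (trans (sym eq) μe≡f , tgt≡v)

  Sink-update⁻ : ∀ {μ : Marking B} {f d v} → ¬ Incident B f v → Sink B (update B μ f d) v → Sink B μ v
  Sink-update⁻ {μ} {d = d} f≁v sink e e∼v =
    PointsInto-resp {μ = μ} {μ′ = update B μ _ d} (update-≢ μ d λ { refl → f≁v e∼v }) (sink e e∼v)

  Source-update⁻ : ∀ {μ : Marking B} {f d v} → ¬ Incident B f v → Source B (update B μ f d) v → Source B μ v
  Source-update⁻ {μ} {d = d} f≁v source e e∼v =
    PointsOut-resp {μ = μ} {μ′ = update B μ _ d} (update-≢ μ d λ { refl → f≁v e∼v }) (source e e∼v)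

-- Mirror strategies

-- τ reflects the drawing and σ is the induced map on edges; by τ-src the reflection reverses the
-- reference orientation, so the mirror image of the arrow μ e on e is the arrow μ e on σ e.
record MirrorSymmetry (B : Board) : Set where
  field
    σ            : Fin (numE B) → Fin (numE B)
    τ            : Fin (numV B) → Fin (numV B)
    σ-involutive : ∀ e → σ (σ e) ≡ e
    τ-involutive : ∀ v → τ (τ v) ≡ v
    τ-src        : ∀ e → τ (src B e) ≡ tgt B (σ e)
    σ-boundary   : ∀ c e → OnBoundary B c e → OnBoundary B c (σ e)

module MirrorStrategy
  {B : Board}
  (loopless         : ∀ e → src B e ≢ tgt B e)
  (noParallel       : ∀ e f → src B e ≡ src B f → tgt B e ≡ tgt B f → e ≡ f)
  (src-surjective   : ∀ v → ∃ λ e → src B e ≡ v)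
  (twoBoundaryEdges : ∀ c → ∃ λ e → ∃ λ f → e ≢ f × OnBoundary B c e × OnBoundary B c f)
  (hasCycleCell?    : ∀ μ → Dec (HasCycleCell B μ))
  (S : MirrorSymmetry B)
  where

  open MarkingProperties B
  open MirrorSymmetry S
  open ≡-Reasoning

  τ-inverse : ∀ {v w} → τ v ≡ w → v ≡ τ w
  τ-inverse {v} τv≡w = trans (sym (τ-involutive v)) (cong τ τv≡w)

  τ-tgt : ∀ e → τ (tgt B e) ≡ src B (σ e)
  τ-tgt e = sym (τ-inverse (trans (τ-src (σ e)) (cong (tgt B) (σ-involutive e))))

  σ-injective : ∀ {e f} → σ e ≡ σ f → e ≡ f
  σ-injective {e} {f} σe≡σf = trans (sym (σ-involutive e)) (trans (cong σ σe≡σf) (σ-involutive f))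

  Incident-mirror : ∀ {e v} → Incident B e (τ v) → Incident B (σ e) v
  Incident-mirror {e} {v} (inj₁ src≡τv) =
    inj₂ (trans (sym (τ-src e)) (trans (cong τ src≡τv) (τ-involutive v)))
  Incident-mirror {e} {v} (inj₂ tgt≡τv) =
    inj₁ (trans (sym (τ-tgt e)) (trans (cong τ tgt≡τv) (τ-involutive v)))

  Symmetric : Marking B → Set
  Symmetric μ = ∀ e → μ (σ e) ≡ μ e

  Sink⇒mirror-Source : ∀ {μ v} → Symmetric μ → Sink B μ v → Source B μ (τ v)
  Sink⇒mirror-Source {μ} symμ sink e e∼τv with sink (σ e) (Incident-mirror e∼τv)
  ... | inj₁ (μσe≡t , tgt≡v) = inj₁ (trans (sym (symμ e)) μσe≡t , τ-inverse (trans (τ-src e) tgt≡v))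
  ... | inj₂ (μσe≡f , src≡v) = inj₂ (trans (sym (symμ e)) μσe≡f , τ-inverse (trans (τ-tgt e) src≡v))

  Source⇒mirror-Sink : ∀ {μ v} → Symmetric μ → Source B μ v → Sink B μ (τ v)
  Source⇒mirror-Sink {μ} symμ source e e∼τv with source (σ e) (Incident-mirror e∼τv)
  ... | inj₁ (μσe≡t , src≡v) = inj₁ (trans (sym (symμ e)) μσe≡t , τ-inverse (trans (τ-tgt e) src≡v))
  ... | inj₂ (μσe≡f , tgt≡v) = inj₂ (trans (sym (symμ e)) μσe≡f , τ-inverse (trans (τ-src e) tgt≡v))

  joins-mirror-pair⇒fixed : ∀ {e v} → v ≢ τ v → Incident B e v → Incident B e (τ v) → σ e ≡ e
  joins-mirror-pair⇒fixed v≢τv (inj₁ src≡v) (inj₁ src≡τv) = ⊥-elim (v≢τv (trans (sym src≡v) src≡τv))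
  joins-mirror-pair⇒fixed v≢τv (inj₂ tgt≡v) (inj₂ tgt≡τv) = ⊥-elim (v≢τv (trans (sym tgt≡v) tgt≡τv))
  joins-mirror-pair⇒fixed {e} {v} _ (inj₁ src≡v) (inj₂ tgt≡τv) = noParallel (σ e) e
    (begin
      src B (σ e) ≡⟨ τ-tgt e ⟨ τ (tgt B e) ≡⟨ cong τ tgt≡τv ⟩ τ (τ v) ≡⟨ τ-involutive v ⟩
      v           ≡⟨ src≡v ⟨ src B e ∎)
    (begin
      tgt B (σ e) ≡⟨ τ-src e ⟨ τ (src B e) ≡⟨ cong τ src≡v ⟩ τ v ≡⟨ tgt≡τv ⟨ tgt B e ∎)
  joins-mirror-pair⇒fixed {e} {v} _ (inj₂ tgt≡v) (inj₁ src≡τv) = noParallel (σ e) e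
    (begin
      src B (σ e) ≡⟨ τ-tgt e ⟨ τ (tgt B e) ≡⟨ cong τ tgt≡v ⟩ τ v ≡⟨ src≡τv ⟨ src B e ∎)
    (begin
      tgt B (σ e) ≡⟨ τ-src e ⟨ τ (src B e) ≡⟨ cong τ src≡τv ⟩ τ (τ v) ≡⟨ τ-involutive v ⟩
      v           ≡⟨ tgt≡v ⟨ tgt B e ∎)

  mirrorReply : Marking B → Fin (numE B) → Bool → Marking B
  mirrorReply μ e d = update B (update B μ e d) (σ e) d

  mirrorReply-at : ∀ (μ : Marking B) e d → mirrorReply μ e d e ≡ just d
  mirrorReply-at μ e d = update-preserves (update B μ e d) (σ e) (update-≡ μ e d)

  mirrorReply-at-σ : ∀ (μ : Marking B) e d → mirrorReply μ e d (σ e) ≡ just d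
  mirrorReply-at-σ μ e d = update-≡ (update B μ e d) (σ e) d

  mirrorReply-elsewhere : ∀ (μ : Marking B) {e d x} → x ≢ e → x ≢ σ e → mirrorReply μ e d x ≡ μ x
  mirrorReply-elsewhere μ {e} {d} x≢e x≢σe = trans (update-≢ (update B μ e d) d x≢σe) (update-≢ μ d x≢e)

  mirrorReply-symmetric : ∀ {μ} e d → Symmetric μ → Symmetric (mirrorReply μ e d)
  mirrorReply-symmetric {μ} e d symμ x = by-cases (x ≟ e) (x ≟ σ e)
    where
    by-cases : Dec (x ≡ e) → Dec (x ≡ σ e) → mirrorReply μ e d (σ x) ≡ mirrorReply μ e d x
    by-cases (yes refl) _ = trans (mirrorReply-at-σ μ e d) (sym (mirrorReply-at μ e d))
    by-cases (no _) (yes refl) = begin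
      mirrorReply μ e d (σ (σ e)) ≡⟨ cong (mirrorReply μ e d) (σ-involutive e) ⟩
      mirrorReply μ e d e         ≡⟨ mirrorReply-at μ e d ⟩
      just d                      ≡⟨ mirrorReply-at-σ μ e d ⟨
      mirrorReply μ e d (σ e)     ∎
    by-cases (no x≢e) (no x≢σe) = begin
      mirrorReply μ e d (σ x) ≡⟨ mirrorReply-elsewhere μ σx≢e (x≢e ∘ σ-injective) ⟩
      μ (σ x)                 ≡⟨ symμ x ⟩
      μ x                     ≡⟨ mirrorReply-elsewhere μ x≢e x≢σe ⟨
      mirrorReply μ e d x     ∎
      where
      σx≢e : σ x ≢ e
      σx≢e σx≡e = x≢σe (trans (sym (σ-involutive x)) (cong σ σx≡e))

  record MirrorPosition (μ : Marking B) : Set where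
    field
      symmetric        : Symmetric μ
      unmarked-unfixed : ∀ e → μ e ≡ nothing → σ e ≢ e
      noCycleCell      : ¬ HasCycleCell B μ

  module _ {μ : Marking B} (P : MirrorPosition μ) where
    open MirrorPosition P

    mirror-of-move-unmarked : ∀ {e d} → μ e ≡ nothing → update B μ e d (σ e) ≡ nothing
    mirror-of-move-unmarked {e} {d} un = trans (update-≢ μ d (unmarked-unfixed e un)) (trans (symmetric e) un)

    move-creates-no-cycleCell : ∀ {e d} → μ e ≡ nothing → ¬ HasCycleCell B (update B μ e d)
    move-creates-no-cycleCell {e} un (c , cycle) =
      cycleCell-marked cycle (σ-boundary c e (new-cycleCell-contains-move noCycleCell cycle))
                       (mirror-of-move-unmarked un)

    mirrorReply-legal : ∀ {e d} → Legal B μ e d → Legal B (update B μ e d) (σ e) d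
    mirrorReply-legal {e} {d} (un , safe) =
      mirror-of-move-unmarked un , λ v → no-sink v , no-sink (τ v) ∘ Source⇒mirror-Sink reply-symmetric
      where
      reply-symmetric : Symmetric (mirrorReply μ e d)
      reply-symmetric = mirrorReply-symmetric e d symmetric
      no-sink : ∀ v → ¬ Sink B (mirrorReply μ e d) v
      no-sink v sink with Incident? (σ e) v | Incident? (σ e) (τ v)
      ... | no σe≁v | _ = proj₁ (safe v) (Sink-update⁻ σe≁v sink)
      ... | yes _ | no σe≁τv =
        proj₂ (safe (τ v)) (Source-update⁻ σe≁τv (Sink⇒mirror-Source reply-symmetric sink))
      ... | yes σe∼v | yes σe∼τv with v ≟ τ v
      ...   | no v≢τv = unmarked-unfixed e un
                          (trans (sym (joins-mirror-pair⇒fixed v≢τv σe∼v σe∼τv)) (σ-involutive e))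
      ...   | yes v≡τv =
        loopless (σ e) (points-into-and-out⇒loop {mirrorReply μ e d} (sink (σ e) σe∼v) σe-out-of-v)
        where
        σe-out-of-v : PointsOut B (mirrorReply μ e d) (σ e) v
        σe-out-of-v = subst (PointsOut B (mirrorReply μ e d) (σ e)) (sym v≡τv)
                            (Sink⇒mirror-Source reply-symmetric sink (σ e) σe∼τv)

    mirrorReply-decreases-unmarkedCount : ∀ {e d} → Legal B μ e d →
                                          unmarkedCount (mirrorReply μ e d) < unmarkedCount μ
    mirrorReply-decreases-unmarkedCount {e} {d} legal@(un , _) =
      ℕₚ.<-trans (update-decreases-unmarkedCount _ (σ e) d (proj₁ (mirrorReply-legal legal)))
                 (update-decreases-unmarkedCount μ e d un)

    mirrorReply-position : ∀ {e d} → ¬ HasCycleCell B (mirrorReply μ e d) →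
                           MirrorPosition (mirrorReply μ e d)
    mirrorReply-position {e} {d} noCycle = record
      { symmetric        = mirrorReply-symmetric e d symmetric
      ; unmarked-unfixed = λ x un →
          unmarked-unfixed x (update-unmarked μ e d (update-unmarked (update B μ e d) (σ e) d un))
      ; noCycleCell      = noCycle
      }

  mirror-loses : ∀ {μ} → MirrorPosition μ → Lose B μ
  mirror-loses {μ} = go μ (<-wellFounded (unmarkedCount μ))
    where
    go : ∀ μ → Acc _<_ (unmarkedCount μ) → MirrorPosition μ → Lose B μ
    go μ (acc smaller) P = lose λ e d legal →
      move-creates-no-cycleCell P (proj₁ legal) , win (σ e) d (mirrorReply-legal P legal) (answer legal)
      where
      answer : ∀ {e d} → Legal B μ e d → HasCycleCell B (mirrorReply μ e d) ⊎ Lose B (mirrorReply μ e d)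
      answer {e} {d} legal with hasCycleCell? (mirrorReply μ e d)
      ... | yes cycle  = inj₁ cycle
      ... | no noCycle = inj₂ (go _ (smaller (mirrorReply-decreases-unmarkedCount P legal))
                                    (mirrorReply-position P noCycle))

  another-incident-edge : ∀ v e → ∃ λ f → f ≢ e × Incident B f v
  another-incident-edge v e with src-surjective v | src-surjective (τ v)
  ... | out , src≡v | e′ , src≡τv with out ≟ e
  ...   | no out≢e = out , out≢e , inj₁ src≡v
  ...   | yes refl = σ e′ , in≢out , inj₂ tgt≡v
    where
    tgt≡v : tgt B (σ e′) ≡ v
    tgt≡v = trans (sym (τ-src e′)) (trans (cong τ src≡τv) (τ-involutive v))
    in≢out : σ e′ ≢ out
    in≢out refl = loopless out (trans src≡v (sym tgt≡v))

  lone-move-legal : ∀ e d → Legal B (empty B) e d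
  lone-move-legal e d = refl , λ v →
    let f , f≢e , f∼v = another-incident-edge v e
        f-unmarked    = update-≢ (empty B) d f≢e
    in (λ sink → unmarked-¬PointsInto {update B (empty B) e d} f-unmarked (sink f f∼v)) ,
       (λ source → unmarked-¬PointsOut {update B (empty B) e d} f-unmarked (source f f∼v))

  empty-no-cycleCell : ¬ HasCycleCell B (empty B)
  empty-no-cycleCell (c , cycle) with twoBoundaryEdges c
  ... | e , _ , _ , e∈c , _ = cycleCell-marked cycle e∈c refl

  lone-mark-no-cycleCell : ∀ {μ e} → (∀ x → x ≢ e → μ x ≡ nothing) → ¬ HasCycleCell B μ
  lone-mark-no-cycleCell {e = e} others (c , cycle) with twoBoundaryEdges c
  ... | f , g , f≢g , f∈c , g∈c with f ≟ e
  ...   | no f≢e   = cycleCell-marked cycle f∈c (others f f≢e)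
  ...   | yes refl = cycleCell-marked cycle g∈c (others g (f≢g ∘ sym))

  player2-wins : (∀ e → σ e ≢ e) → Player2Wins B
  player2-wins unfixed = mirror-loses record
    { symmetric        = λ _ → refl
    ; unmarked-unfixed = λ e _ → unfixed e
    ; noCycleCell      = empty-no-cycleCell
    }

  player1-wins : ∀ e₀ → σ e₀ ≡ e₀ → (∀ e → σ e ≡ e → e ≡ e₀) → Player1Wins B
  player1-wins e₀ fixed unique = win e₀ true (lone-move-legal e₀ true) (inj₂ (mirror-loses position))
    where
    μ₁ : Marking B
    μ₁ = update B (empty B) e₀ true
    others : ∀ x → x ≢ e₀ → μ₁ x ≡ nothing
    others x = update-≢ (empty B) true
    symmetric : Symmetric μ₁
    symmetric x = by-cases (x ≟ e₀)
      where
      by-cases : Dec (x ≡ e₀) → μ₁ (σ x) ≡ μ₁ x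
      by-cases (yes refl) = cong μ₁ fixed
      by-cases (no x≢e₀)  = trans (others (σ x) σx≢e₀) (sym (others x x≢e₀))
        where
        σx≢e₀ : σ x ≢ e₀
        σx≢e₀ σx≡e₀ = x≢e₀ (trans (sym (σ-involutive x)) (trans (cong σ σx≡e₀) fixed))
    position : MirrorPosition μ₁
    position = record
      { symmetric        = symmetric
      ; unmarked-unfixed = λ x un σx≡x →
          nothing≢just (trans (sym un) (trans (cong μ₁ (unique x σx≡x)) (update-≡ (empty B) e₀ true)))
      ; noCycleCell      = lone-mark-no-cycleCell others
      }

-- Positions on a cycle

toℕ-next : ∀ {k} (i : Fin (suc k)) → toℕ i < k → toℕ (next i) ≡ suc (toℕ i)
toℕ-next {k} i i<k with toℕ i ℕₚ.<? k
... | yes i<k′ = Finₚ.toℕ-fromℕ< (s≤s i<k′)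
... | no i≮k   = ⊥-elim (i≮k i<k)

next-last : ∀ {k} (i : Fin (suc k)) → ¬ toℕ i < k → next i ≡ zero
next-last {k} i i≮k with toℕ i ℕₚ.<? k
... | yes i<k = ⊥-elim (i≮k i<k)
... | no _    = refl

next-≢ : ∀ {k} (i : Fin (suc (suc k))) → next i ≢ i
next-≢ {k} i next≡i = by-cases (toℕ i ℕₚ.<? suc k)
  where
  by-cases : Dec (toℕ i < suc k) → ⊥
  by-cases (yes i<k) = ℕₚ.1+n≢n (trans (sym (toℕ-next i i<k)) (cong toℕ next≡i))
  by-cases (no i≮k)  = i≮k (subst (λ j → toℕ j < suc k) (trans (sym (next-last i i≮k)) next≡i) (s≤s z≤n))

-- The position mirror to k on a cycle whose position zero is the shared vertex.
reflect : ∀ {k} → Fin (suc k) → Fin (suc k)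
reflect zero    = zero
reflect (suc i) = suc (opposite i)

reflect-involutive : ∀ {k} (i : Fin (suc k)) → reflect (reflect i) ≡ i
reflect-involutive zero    = refl
reflect-involutive (suc i) = cong suc (Finₚ.opposite-involutive i)

reflect≡next∘opposite : ∀ {k} (i : Fin (suc k)) → reflect i ≡ next (opposite i)
reflect≡next∘opposite {k} zero = sym (next-last (opposite zero) (ℕₚ.<-irrefl (Finₚ.toℕ-fromℕ k)))
reflect≡next∘opposite {suc k} (suc i) = Finₚ.toℕ-injective (begin
  suc (toℕ (opposite i))          ≡⟨ cong suc (Finₚ.opposite-suc i) ⟨
  suc (toℕ (opposite (suc i)))    ≡⟨ toℕ-next (opposite (suc i)) in-range ⟨
  toℕ (next (opposite (suc i)))   ∎)
  where
  open ≡-Reasoning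
  in-range : toℕ (opposite (suc i)) < suc k
  in-range = subst (_< suc k) (sym (Finₚ.opposite-suc i)) (Finₚ.toℕ<n (opposite i))

module _ {k : ℕ} where
  open ≡-Reasoning

  opposite-fixed⇒double : (i : Fin (suc k)) → opposite i ≡ i → k ≡ toℕ i + toℕ i
  opposite-fixed⇒double i fixed = begin
    k                  ≡⟨ ℕₚ.m∸n+n≡m (Finₚ.toℕ≤pred[n] i) ⟨
    k ∸ toℕ i + toℕ i  ≡⟨ cong (_+ toℕ i) (trans (sym (Finₚ.opposite-prop i)) (cong toℕ fixed)) ⟩
    toℕ i + toℕ i      ∎

  double⇒opposite-fixed : (i : Fin (suc k)) → k ≡ toℕ i + toℕ i → opposite i ≡ i
  double⇒opposite-fixed i k≡i+i = Finₚ.toℕ-injective (begin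
    toℕ (opposite i)       ≡⟨ Finₚ.opposite-prop i ⟩
    k ∸ toℕ i              ≡⟨ cong (_∸ toℕ i) k≡i+i ⟩
    toℕ i + toℕ i ∸ toℕ i  ≡⟨ ℕₚ.m+n∸n≡m (toℕ i) (toℕ i) ⟩
    toℕ i                  ∎)

  opposite-fixed-unique : {i j : Fin (suc k)} → opposite i ≡ i → opposite j ≡ j → i ≡ j
  opposite-fixed-unique {i} {j} i-fixed j-fixed = Finₚ.toℕ-injective (begin
    toℕ i                    ≡⟨ ℕₚ.n≡⌊n+n/2⌋ (toℕ i) ⟩
    ⌊ toℕ i + toℕ i /2⌋      ≡⟨ cong ⌊_/2⌋ (trans (sym (opposite-fixed⇒double i i-fixed))
                                                   (opposite-fixed⇒double j j-fixed)) ⟩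
    ⌊ toℕ j + toℕ j /2⌋      ≡⟨ ℕₚ.n≡⌊n+n/2⌋ (toℕ j) ⟨
    toℕ j                    ∎)

n+n≡n*2 : ∀ n → n + n ≡ n * 2
n+n≡n*2 n = trans (cong (n +_) (sym (ℕₚ.+-identityʳ n))) (ℕₚ.*-comm 2 n)

n%2≡0⊎n%2≡1 : ∀ n → n % 2 ≡ 0 ⊎ n % 2 ≡ 1
n%2≡0⊎n%2≡1 n with n % 2 | m%n<n n 2
... | 0           | _               = inj₁ refl
... | 1           | _               = inj₂ refl
... | suc (suc _) | s≤s (s≤s ())

suc[n+n]%2≡1 : ∀ n → suc (n + n) % 2 ≡ 1
suc[n+n]%2≡1 n = trans (cong (λ m → suc m % 2) (n+n≡n*2 n)) ([m+kn]%n≡m%n 1 n 2)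

suc[n]%2≡1⇒n≡h+h : ∀ n → suc n % 2 ≡ 1 → ∃ λ h → n ≡ h + h
suc[n]%2≡1⇒n≡h+h n odd = h , ℕₚ.suc-injective (begin
  suc n                ≡⟨ m≡m%n+[m/n]*n (suc n) 2 ⟩
  suc n % 2 + h * 2    ≡⟨ cong (_+ h * 2) odd ⟩
  suc (h * 2)          ≡⟨ cong suc (n+n≡n*2 h) ⟨
  suc (h + h)          ∎)
  where
  open ≡-Reasoning
  h : ℕ
  h = suc n / 2

even⇒opposite-unfixed : ∀ {k} → suc k % 2 ≡ 0 → (i : Fin (suc k)) → opposite i ≢ i
even⇒opposite-unfixed {k} even i fixed
  with () ← trans (sym even) (trans (cong (λ m → suc m % 2) (opposite-fixed⇒double i fixed))
                                    (suc[n+n]%2≡1 (toℕ i)))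

odd⇒opposite-fixed : ∀ {k} → suc k % 2 ≡ 1 → ∃ λ (i : Fin (suc k)) → opposite i ≡ i
odd⇒opposite-fixed {k} odd with suc[n]%2≡1⇒n≡h+h k odd
... | h , k≡h+h = middle , double⇒opposite-fixed middle (trans k≡h+h (cong (λ m → m + m) (sym toℕ-middle)))
  where
  h<suc[k] : h < suc k
  h<suc[k] = s≤s (subst (h ≤_) (sym k≡h+h) (ℕₚ.m≤m+n h h))
  middle : Fin (suc k)
  middle = fromℕ< h<suc[k]
  toℕ-middle : toℕ middle ≡ h
  toℕ-middle = Finₚ.toℕ-fromℕ< h<suc[k]

-- The board C_m ∨ C_n

module TwoCycles (a′ b′ : ℕ) where
  open ≡-Reasoning

  a b : ℕ
  a = suc a′
  b = suc b′

  B : Board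
  B = twoCyclesBoard a b

  data EdgeView : Fin (numE B) → Set where
    first  : (i : Fin (suc a)) → EdgeView (i ↑ˡ suc b)
    second : (j : Fin (suc b)) → EdgeView (suc a ↑ʳ j)

  edgeView : ∀ e → EdgeView e
  edgeView e with splitAt (suc a) e in eq
  ... | inj₁ i = subst EdgeView (Finₚ.splitAt⁻¹-↑ˡ eq) (first i)
  ... | inj₂ j = subst EdgeView (Finₚ.splitAt⁻¹-↑ʳ eq) (second j)

  data VertexView : Fin (numV B) → Set where
    first  : (k : Fin (suc a)) → VertexView (pos₁ a b k)
    second : (k : Fin (suc b)) → VertexView (pos₂ a b k)

  vertexView : ∀ v → VertexView v
  vertexView zero = first zero
  vertexView (suc w) with splitAt a w in eq
  ... | inj₁ i = subst VertexView (cong suc (Finₚ.splitAt⁻¹-↑ˡ eq)) (first (suc i))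
  ... | inj₂ j = subst VertexView (cong suc (Finₚ.splitAt⁻¹-↑ʳ eq)) (second (suc j))

  src-first : (i : Fin (suc a)) → src B (i ↑ˡ suc b) ≡ pos₁ a b i
  src-first i rewrite Finₚ.splitAt-↑ˡ (suc a) i (suc b) = refl

  tgt-first : (i : Fin (suc a)) → tgt B (i ↑ˡ suc b) ≡ pos₁ a b (next i)
  tgt-first i rewrite Finₚ.splitAt-↑ˡ (suc a) i (suc b) = refl

  src-second : (j : Fin (suc b)) → src B (suc a ↑ʳ j) ≡ pos₂ a b j
  src-second j rewrite Finₚ.splitAt-↑ʳ (suc a) (suc b) j = refl

  tgt-second : (j : Fin (suc b)) → tgt B (suc a ↑ʳ j) ≡ pos₂ a b (next j)
  tgt-second j rewrite Finₚ.splitAt-↑ʳ (suc a) (suc b) j = refl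

  -- Edge i of a cycle runs from position i to next i, so its mirror image is edge (opposite i).
  σ : Fin (numE B) → Fin (numE B)
  σ e = [ (λ i → opposite i ↑ˡ suc b) , (λ j → suc a ↑ʳ opposite j) ] (splitAt (suc a) e)

  τ : Fin (numV B) → Fin (numV B)
  τ zero    = zero
  τ (suc w) = suc ([ (λ i → opposite i ↑ˡ b) , (λ j → a ↑ʳ opposite j) ] (splitAt a w))

  σ-first : (i : Fin (suc a)) → σ (i ↑ˡ suc b) ≡ opposite i ↑ˡ suc b
  σ-first i rewrite Finₚ.splitAt-↑ˡ (suc a) i (suc b) = refl

  σ-second : (j : Fin (suc b)) → σ (suc a ↑ʳ j) ≡ suc a ↑ʳ opposite j
  σ-second j rewrite Finₚ.splitAt-↑ʳ (suc a) (suc b) j = refl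

  τ-pos₁ : ∀ k → τ (pos₁ a b k) ≡ pos₁ a b (reflect k)
  τ-pos₁ zero    = refl
  τ-pos₁ (suc i) rewrite Finₚ.splitAt-↑ˡ a i b = refl

  τ-pos₂ : ∀ k → τ (pos₂ a b k) ≡ pos₂ a b (reflect k)
  τ-pos₂ zero    = refl
  τ-pos₂ (suc j) rewrite Finₚ.splitAt-↑ʳ a b j = refl

  σ-involutive : ∀ e → σ (σ e) ≡ e
  σ-involutive e with edgeView e
  ... | first i = begin
    σ (σ (i ↑ˡ suc b))               ≡⟨ cong σ (σ-first i) ⟩
    σ (opposite i ↑ˡ suc b)          ≡⟨ σ-first (opposite i) ⟩
    opposite (opposite i) ↑ˡ suc b   ≡⟨ cong (_↑ˡ suc b) (Finₚ.opposite-involutive i) ⟩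
    i ↑ˡ suc b                       ∎
  ... | second j = begin
    σ (σ (suc a ↑ʳ j))               ≡⟨ cong σ (σ-second j) ⟩
    σ (suc a ↑ʳ opposite j)          ≡⟨ σ-second (opposite j) ⟩
    suc a ↑ʳ opposite (opposite j)   ≡⟨ cong (suc a ↑ʳ_) (Finₚ.opposite-involutive j) ⟩
    suc a ↑ʳ j                       ∎

  τ-involutive : ∀ v → τ (τ v) ≡ v
  τ-involutive v with vertexView v
  ... | first k  =
    trans (cong τ (τ-pos₁ k)) (trans (τ-pos₁ (reflect k)) (cong (pos₁ a b) (reflect-involutive k)))
  ... | second k =
    trans (cong τ (τ-pos₂ k)) (trans (τ-pos₂ (reflect k)) (cong (pos₂ a b) (reflect-involutive k)))

  τ-src : ∀ e → τ (src B e) ≡ tgt B (σ e)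
  τ-src e with edgeView e
  ... | first i = begin
    τ (src B (i ↑ˡ suc b))              ≡⟨ cong τ (src-first i) ⟩
    τ (pos₁ a b i)                      ≡⟨ τ-pos₁ i ⟩
    pos₁ a b (reflect i)                ≡⟨ cong (pos₁ a b) (reflect≡next∘opposite i) ⟩
    pos₁ a b (next (opposite i))        ≡⟨ tgt-first (opposite i) ⟨
    tgt B (opposite i ↑ˡ suc b)         ≡⟨ cong (tgt B) (σ-first i) ⟨
    tgt B (σ (i ↑ˡ suc b))              ∎
  ... | second j = begin
    τ (src B (suc a ↑ʳ j))              ≡⟨ cong τ (src-second j) ⟩
    τ (pos₂ a b j)                      ≡⟨ τ-pos₂ j ⟩
    pos₂ a b (reflect j)                ≡⟨ cong (pos₂ a b) (reflect≡next∘opposite j) ⟩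
    pos₂ a b (next (opposite j))        ≡⟨ tgt-second (opposite j) ⟨
    tgt B (suc a ↑ʳ opposite j)         ≡⟨ cong (tgt B) (σ-second j) ⟨
    tgt B (σ (suc a ↑ʳ j))              ∎

  first-on-boundary : ∀ i → OnBoundary B cell₁ (i ↑ˡ suc b)
  first-on-boundary i = true , ∈-map⁺ (λ i → (i ↑ˡ suc b) , true) (∈-allFin i)

  second-on-boundary : ∀ j → OnBoundary B cell₂ (suc a ↑ʳ j)
  second-on-boundary j = true , ∈-map⁺ (λ j → (suc a ↑ʳ j) , true) (∈-allFin j)

  σ-boundary : ∀ c e → OnBoundary B c e → OnBoundary B c (σ e)
  σ-boundary cell₁ e (_ , e∈c) with ∈-map⁻ (λ i → (i ↑ˡ suc b) , true) e∈c
  ... | i , _ , refl = subst (OnBoundary B cell₁) (sym (σ-first i)) (first-on-boundary (opposite i))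
  σ-boundary cell₂ e (_ , e∈c) with ∈-map⁻ (λ j → (suc a ↑ʳ j) , true) e∈c
  ... | j , _ , refl = subst (OnBoundary B cell₂) (sym (σ-second j)) (second-on-boundary (opposite j))

  twoBoundaryEdges : ∀ c → ∃ λ e → ∃ λ f → e ≢ f × OnBoundary B c e × OnBoundary B c f
  twoBoundaryEdges cell₁ =
    zero {a} ↑ˡ suc b , suc zero ↑ˡ suc b , Finₚ.0≢1+n ∘ Finₚ.↑ˡ-injective (suc b) zero (suc zero) ,
    first-on-boundary zero , first-on-boundary (suc zero)
  twoBoundaryEdges cell₂ =
    suc a ↑ʳ zero {b} , suc a ↑ʳ suc zero , Finₚ.0≢1+n ∘ Finₚ.↑ʳ-injective (suc a) zero (suc zero) ,
    second-on-boundary zero , second-on-boundary (suc zero)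

  hasCycleCell? : ∀ μ → Dec (HasCycleCell B μ)
  hasCycleCell? μ with cycleCell? B μ cell₁ | cycleCell? B μ cell₂
  ... | yes cycle₁ | _          = yes (cell₁ , cycle₁)
  ... | no _       | yes cycle₂ = yes (cell₂ , cycle₂)
  ... | no ¬cycle₁ | no ¬cycle₂ =
    no λ { (cell₁ , cycle₁) → ¬cycle₁ cycle₁ ; (cell₂ , cycle₂) → ¬cycle₂ cycle₂ }

  mirrorSymmetry : MirrorSymmetry B
  mirrorSymmetry = record
    { σ = σ ; τ = τ ; σ-involutive = σ-involutive ; τ-involutive = τ-involutive
    ; τ-src = τ-src ; σ-boundary = σ-boundary }

  pos₁-injective : ∀ {k l} → pos₁ a b k ≡ pos₁ a b l → k ≡ l
  pos₁-injective {zero}  {zero}  _ = refl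
  pos₁-injective {suc i} {suc j} p = cong suc (Finₚ.↑ˡ-injective b i j (Finₚ.suc-injective p))

  pos₂-injective : ∀ {k l} → pos₂ a b k ≡ pos₂ a b l → k ≡ l
  pos₂-injective {zero}  {zero}  _ = refl
  pos₂-injective {suc i} {suc j} p = cong suc (Finₚ.↑ʳ-injective a i j (Finₚ.suc-injective p))

  pos₁≡pos₂⇒shared : ∀ {k l} → pos₁ a b k ≡ pos₂ a b l → k ≡ zero × l ≡ zero
  pos₁≡pos₂⇒shared {zero}  {zero}  _ = refl , refl
  pos₁≡pos₂⇒shared {suc i} {suc j} p = ⊥-elim (ℕₚ.<-irrefl refl (ℕₚ.<-≤-trans a+j<a (ℕₚ.m≤m+n a (toℕ j))))
    where
    a+j<a : a + toℕ j < a
    a+j<a = subst (_< a) (begin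
      toℕ i            ≡⟨ Finₚ.toℕ-↑ˡ i b ⟨
      toℕ (i ↑ˡ b)     ≡⟨ cong toℕ (Finₚ.suc-injective p) ⟩
      toℕ (a ↑ʳ j)     ≡⟨ Finₚ.toℕ-↑ʳ a j ⟩
      a + toℕ j        ∎) (Finₚ.toℕ<n i)

  loopless : ∀ e → src B e ≢ tgt B e
  loopless e src≡tgt with edgeView e
  ... | first i  = next-≢ i (sym (pos₁-injective (trans (sym (src-first i)) (trans src≡tgt (tgt-first i)))))
  ... | second j = next-≢ j (sym (pos₂-injective (trans (sym (src-second j)) (trans src≡tgt (tgt-second j)))))

  first-second-not-parallel : ∀ i j → src B (i ↑ˡ suc b) ≡ src B (suc a ↑ʳ j) →
                              tgt B (i ↑ˡ suc b) ≢ tgt B (suc a ↑ʳ j)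
  first-second-not-parallel i j src≡ tgt≡
    with pos₁≡pos₂⇒shared (trans (sym (src-first i)) (trans src≡ (src-second j)))
  ... | refl , refl =
    next-≢ zero (proj₁ (pos₁≡pos₂⇒shared (trans (sym (tgt-first zero)) (trans tgt≡ (tgt-second zero)))))

  noParallel : ∀ e f → src B e ≡ src B f → tgt B e ≡ tgt B f → e ≡ f
  noParallel e f src≡ tgt≡ with edgeView e | edgeView f
  ... | first i  | first i′  =
    cong (_↑ˡ suc b) (pos₁-injective (trans (sym (src-first i)) (trans src≡ (src-first i′))))
  ... | second j | second j′ =
    cong (suc a ↑ʳ_) (pos₂-injective (trans (sym (src-second j)) (trans src≡ (src-second j′))))
  ... | first i  | second j  = ⊥-elim (first-second-not-parallel i j src≡ tgt≡)
  ... | second j | first i   = ⊥-elim (first-second-not-parallel i j (sym src≡) (sym tgt≡))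

  src-surjective : ∀ v → ∃ λ e → src B e ≡ v
  src-surjective v with vertexView v
  ... | first k  = k ↑ˡ suc b , src-first k
  ... | second k = suc a ↑ʳ k , src-second k

  fixed-edge : ∀ e → σ e ≡ e →
               (∃ λ i → e ≡ i ↑ˡ suc b × opposite i ≡ i) ⊎ (∃ λ j → e ≡ suc a ↑ʳ j × opposite j ≡ j)
  fixed-edge e fixed with edgeView e
  ... | first i  = inj₁ (i , refl , Finₚ.↑ˡ-injective (suc b) _ _ (trans (sym (σ-first i)) fixed))
  ... | second j = inj₂ (j , refl , Finₚ.↑ʳ-injective (suc a) _ _ (trans (sym (σ-second j)) fixed))

  open MirrorStrategy loopless noParallel src-surjective twoBoundaryEdges hasCycleCell? mirrorSymmetry
    using (player1-wins; player2-wins)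

  player2-wins-if-both-even : suc a % 2 ≡ 0 → suc b % 2 ≡ 0 → Player2Wins B
  player2-wins-if-both-even even₁ even₂ = player2-wins λ e fixed →
    [ (λ (i , _ , i-fixed) → even⇒opposite-unfixed even₁ i i-fixed)
    , (λ (j , _ , j-fixed) → even⇒opposite-unfixed even₂ j j-fixed)
    ] (fixed-edge e fixed)

  player1-wins-if-first-odd : suc a % 2 ≡ 1 → suc b % 2 ≡ 0 → Player1Wins B
  player1-wins-if-first-odd odd₁ even₂ =
    let i , i-fixed = odd⇒opposite-fixed odd₁ in
    player1-wins (i ↑ˡ suc b) (trans (σ-first i) (cong (_↑ˡ suc b) i-fixed)) λ e fixed →
      [ (λ (i′ , e≡i′ , i′-fixed) → trans e≡i′ (cong (_↑ˡ suc b) (opposite-fixed-unique i′-fixed i-fixed)))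
      , (λ (j , _ , j-fixed) → ⊥-elim (even⇒opposite-unfixed even₂ j j-fixed))
      ] (fixed-edge e fixed)

  player1-wins-if-second-odd : suc a % 2 ≡ 0 → suc b % 2 ≡ 1 → Player1Wins B
  player1-wins-if-second-odd even₁ odd₂ =
    let j , j-fixed = odd⇒opposite-fixed odd₂ in
    player1-wins (suc a ↑ʳ j) (trans (σ-second j) (cong (suc a ↑ʳ_) j-fixed)) λ e fixed →
      [ (λ (i , _ , i-fixed) → ⊥-elim (even⇒opposite-unfixed even₁ i i-fixed))
      , (λ (j′ , e≡j′ , j′-fixed) → trans e≡j′ (cong (suc a ↑ʳ_) (opposite-fixed-unique j′-fixed j-fixed)))
      ] (fixed-edge e fixed)

  player1-wins-if-parities-differ : ¬ (suc a % 2 ≡ suc b % 2) → Player1Wins B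
  player1-wins-if-parities-differ differ with n%2≡0⊎n%2≡1 (suc a) | n%2≡0⊎n%2≡1 (suc b)
  ... | inj₁ even₁ | inj₁ even₂ = ⊥-elim (differ (trans even₁ (sym even₂)))
  ... | inj₂ odd₁  | inj₂ odd₂  = ⊥-elim (differ (trans odd₁ (sym odd₂)))
  ... | inj₂ odd₁  | inj₁ even₂ = player1-wins-if-first-odd odd₁ even₂
  ... | inj₁ even₁ | inj₂ odd₂  = player1-wins-if-second-odd even₁ odd₂

proposition3p1 : (m n : ℕ) → 3 < m → 3 < n →
    ((¬ (m % 2 ≡ n % 2)) → Player1Wins (twoCycles m n))
    × (m % 2 ≡ 0 → n % 2 ≡ 0 → Player2Wins (twoCycles m n))
-- The argument only needs m, n ≥ 2.
proposition3p1 (suc (suc a′)) (suc (suc b′)) _ _ =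
  player1-wins-if-parities-differ , player2-wins-if-both-even
  where open TwoCycles a′ b′
proposition3p1 zero          _             ()        _
proposition3p1 (suc zero)    _             (s≤s ())  _
proposition3p1 (suc (suc _)) zero          _         ()
proposition3p1 (suc (suc _)) (suc zero)    _         (s≤s ())
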